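{- A finite directed graph with $n$ vertices has $O(n)$ superbubbles.
   Context: "Passing through" a vertex means visiting it and then leaving it (not merely arriving at it or merely starting from it). In a directed graph $G$, an ordered pair of distinct vertices $(s,t)$ satisfies the superbubble conditions if: (reachability) $t$ is reachable from $s$; (matching) the set $U$ of vertices reachable from $s$ without passing through $t$ equals the set of vertices from which $t$ is reachable without passing through $s$; (acyclicity) the subgraph of $G$ induced by $U$ is acyclic; (minimality) no vertex $v\in U$ other than $t$ is such that $(s,v)$ satisfies the reachability, matching and acyclicity conditions. For such a pair, the subgraph induced by $U$ is called a superbubble $\langle s,t\rangle$, with entrance $s$ and exit $t$; distinct such pairs yield distinct superbubbles. -}

module Defs where

open import Data.Bool using (Bool; true)
open import Data.Fin using (Fin)
open import Data.Product using (_×_)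
open import Relation.Binary.PropositionalEquality using (_≡_; _≢_)
open import Relation.Nullary using (¬_)
open import Relation.Binary.Construct.Closure.ReflexiveTransitive using (Star)
open import Relation.Binary.Construct.Closure.Transitive using (TransClosure)

Graph : (n : _) → Set
Graph n = Fin n → Fin n → Bool

module _ {n} (G : Graph n) where

  Edge : Fin n → Fin n → Set
  Edge u v = G u v ≡ true

  Reachable : Fin n → Fin n → Set
  Reachable = Star Edge

  -- AvoidWalk a x y : there is a walk from x to y that does not pass through a,
  -- i.e. no vertex of the walk other than its first and last position equals a.
  data AvoidWalk (a : Fin n) (x : Fin n) : Fin n → Set where
    here   : AvoidWalk a x x
    edge   : ∀ {y} → Edge x y → AvoidWalk a x y
    extend : ∀ {u y} → AvoidWalk a x u → u ≢ a → Edge u y → AvoidWalk a x y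

  InU : Fin n → Fin n → Fin n → Set
  InU s t v = AvoidWalk t s v

  CoReach : Fin n → Fin n → Fin n → Set
  CoReach s t v = AvoidWalk s v t

  Matching : Fin n → Fin n → Set
  Matching s t = ∀ v → (InU s t v → CoReach s t v) × (CoReach s t v → InU s t v)

  EdgeInU : Fin n → Fin n → Fin n → Fin n → Set
  EdgeInU s t u v = InU s t u × InU s t v × Edge u v

  Acyclic : Fin n → Fin n → Set
  Acyclic s t = ∀ v → ¬ TransClosure (EdgeInU s t) v v

  Conditions : Fin n → Fin n → Set
  Conditions s t = Reachable s t × Matching s t × Acyclic s t

  Superbubble : Fin n → Fin n → Set
  Superbubble s t =
    s ≢ t × Conditions s t ×
    (∀ v → InU s t v → v ≢ t → v ≢ s → ¬ Conditions s v)

module Submission where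

-- The whole argument is that the entrance of a superbubble determines its
-- exit.  Suppose ⟨s,t⟩ and ⟨s,t'⟩ are superbubbles with t ≢ t'.  Follow a
-- walk from s to t' (reachability) and stop at the first vertex that is t or
-- t' (the race lemma): the prefix shows either t' ∈ U(s,t) or t ∈ U(s,t').
-- In the first case (s,t') satisfies reachability, matching and acyclicity
-- with t' inside U(s,t), contradicting the minimality of ⟨s,t⟩; the second
-- case is symmetric.
--
-- Consequently projecting a duplicate-free list of superbubbles onto the
-- entrances yields a duplicate-free list of vertices, and a duplicate-free
-- list over Fin n has length at most n (pigeonhole, via an injective lookup).

open import Defs
open import Data.Nat using (ℕ; _≤_; _*_)
open import Data.Fin using (Fin)
open import Data.Product using (_×_; proj₁; proj₂; ∃-syntax)
open import Data.List using (List; length)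
open import Data.List.Relation.Unary.All using (All)
open import Data.List.Relation.Unary.Unique.Propositional using (Unique)

open import Data.Nat.Properties using (*-identityˡ; module ≤-Reasoning)
open import Data.Fin using (zero; suc)
open import Data.Fin.Properties using (_≟_; injective⇒≤)
open import Data.List using ([]; _∷_; map; lookup)
open import Data.List.Properties using (length-map)
open import Data.List.Membership.Propositional.Properties using (∈-lookup)
open import Data.List.Relation.Unary.All using ([]; _∷_)
import Data.List.Relation.Unary.All as All
import Data.List.Relation.Unary.All.Properties as All
open import Data.List.Relation.Unary.AllPairs using ([]; _∷_)
open import Data.Product using (_,_)
open import Data.Sum using (_⊎_; inj₁; inj₂)
open import Data.Empty using (⊥-elim)
open import Function.Definitions using (Injective)
open import Relation.Nullary using (¬_; yes; no; contradiction)
open import Relation.Binary.PropositionalEquality using (_≡_; _≢_; refl; sym; cong)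
open import Relation.Binary.Construct.Closure.ReflexiveTransitive using (ε; _◅_)

module _ {n} (G : Graph n) where

  -- Race lemma: if u lies in both U(s,t) and U(s,t') and is neither t nor t',
  -- then any walk from u to t' meets t or t' first, so t' ∈ U(s,t) or t ∈ U(s,t').
  race : ∀ {s t t' u} → InU G s t u → InU G s t' u → u ≢ t → u ≢ t' →
         Reachable G u t' → InU G s t t' ⊎ InU G s t' t
  race _ _ _ u≢t' ε = contradiction refl u≢t'
  race {t = t} {t'} w w' u≢t u≢t' (_◅_ {j = v} e rest) with v ≟ t'
  ... | yes refl = inj₁ (extend w u≢t e)
  ... | no v≢t' with v ≟ t
  ...   | yes refl = inj₂ (extend w' u≢t' e)
  ...   | no v≢t  = race (extend w u≢t e) (extend w' u≢t' e) v≢t v≢t' rest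

  otherExitOutside : ∀ {s t t'} → Superbubble G s t → Superbubble G s t' →
                     t' ≢ t → ¬ InU G s t t'
  otherExitOutside (_ , _ , minimal) (s≢t' , conditions' , _) t'≢t t'∈U =
    minimal _ t'∈U t'≢t (λ t'≡s → s≢t' (sym t'≡s)) conditions'

  exitUnique : ∀ {s t t'} → Superbubble G s t → Superbubble G s t' → t ≡ t'
  exitUnique {t = t} {t'} sb@(s≢t , _) sb'@(s≢t' , (s↝t' , _) , _) with t ≟ t'
  ... | yes t≡t' = t≡t'
  ... | no t≢t' with race here here s≢t s≢t' s↝t'
  ...   | inj₁ t'∈U  = ⊥-elim (otherExitOutside sb sb' (λ e → t≢t' (sym e)) t'∈U)
  ...   | inj₂ t∈U'  = ⊥-elim (otherExitOutside sb' sb t≢t' t∈U')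

  sameEntrance⇒equal : ∀ {b c : Fin n × Fin n} →
    Superbubble G (proj₁ b) (proj₂ b) → Superbubble G (proj₁ c) (proj₂ c) →
    proj₁ b ≡ proj₁ c → b ≡ c
  sameEntrance⇒equal {s , _} {.s , _} sb sb' refl = cong (s ,_) (exitUnique sb sb')

map-injectiveOn : ∀ {A B : Set} {P : A → Set} (f : A → B) →
                  (∀ {x y} → P x → P y → f x ≡ f y → x ≡ y) →
                  ∀ {xs} → All P xs → Unique xs → Unique (map f xs)
map-injectiveOn f inj [] [] = []
map-injectiveOn f inj (px ∷ pxs) (x∉xs ∷ xs!) =
  All.map⁺ (All.zipWith (λ (x≢y , py) fx≡fy → x≢y (inj px py fx≡fy)) (x∉xs , pxs))
  ∷ map-injectiveOn f inj pxs xs!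

lookup-injective : ∀ {A : Set} {xs : List A} → Unique xs → Injective _≡_ _≡_ (lookup xs)
lookup-injective (_ ∷ _) {zero}  {zero}  _  = refl
lookup-injective (x∉xs ∷ xs!) {zero}  {suc j} eq = contradiction eq (All.lookup x∉xs (∈-lookup j))
lookup-injective (x∉xs ∷ xs!) {suc i} {zero}  eq = contradiction (sym eq) (All.lookup x∉xs (∈-lookup i))
lookup-injective (_ ∷ xs!) {suc i} {suc j} eq = cong suc (lookup-injective xs! eq)

unique-length≤ : ∀ {n} {xs : List (Fin n)} → Unique xs → length xs ≤ n
unique-length≤ xs! = injective⇒≤ (lookup-injective xs!)

mainTheorem3 : ∃[ C ] ∀ (n : ℕ) (G : Graph n) (bs : List (Fin n × Fin n)) →
    Unique bs → All (λ p → Superbubble G (proj₁ p) (proj₂ p)) bs →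
    length bs ≤ C * n
mainTheorem3 = 1 , λ n G bs bs! sbs → begin
  length bs              ≡⟨ length-map proj₁ bs ⟨
  length (map proj₁ bs)  ≤⟨ unique-length≤ (map-injectiveOn proj₁ (sameEntrance⇒equal G) sbs bs!) ⟩
  n                      ≡⟨ *-identityˡ n ⟨
  1 * n                  ∎
  where open ≤-Reasoning
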